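{- Let $X$ be an antipodal domain. (1) An antipodal class $\mathcal H$ over $X$ dually shatters a set $H\subseteq\mathcal H$ if and only if it dually antipodally shatters $H$; in particular $\mathtt{VC}^*(\mathcal H)=\mathtt{VC}^{*\mathrm a}(\mathcal H)$. (2) If $\mathcal H'$ is a symmetrization of a class $\mathcal H$ over $X$, then $\mathtt{VC}(\mathcal H')\le\mathtt{VC}(\mathcal H)$ and $\mathtt{VC}^{*\mathrm a}(\mathcal H')\le\mathtt{VC}^{*\mathrm a}(\mathcal H)$.
   Context: An antipodal domain is a set $X$ with a fixed-point-free involution $x\mapsto-x$. A (total) hypothesis $h:X\to\{ -,+\}$ is antipodal if $h(-x)=-h(x)$ for all $x$; a class (nonempty set of hypotheses) is antipodal if all its hypotheses are. A representation map is $r:X\to X$ such that for every $x$, either $r(x)=r(-x)=x$ or $r(x)=r(-x)=-x$. The symmetrization of $h$ by $r$ is $h^r(x)=h(x)$ if $h(x)=-h(-x)$; $h^r(x)=h(x)$ if $h(x)\ne-h(-x)$ and $x=r(x)$; $h^r(x)=-h(x)$ if $h(x)\ne-h(-x)$ and $x=-r(x)$. For a class $\mathcal H$, $\mathcal H^r=\{h^r:h\in\mathcal H\}$, and $\mathcal H'$ is a symmetrization of $\mathcal H$ if $\mathcal H'=\mathcal H^r$ for some representation map $r$. $\mathtt{VC}$: max size of $S\subseteq X$ on which every pattern $S\to\{ -,+\}$ is realized by a concept. $H\subseteq\mathcal H$ is dually shattered if for every $r:H\to\{ -,+\}$ some $x\in X$ has $h(x)=r(h)$ for all $h\in H$; dually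 antipodally shattered if for every $r$ some $x$ has $h(x)=r(h)$ for all $h\in H$ or $h(x)=-r(h)$ for all $h\in H$. $\mathtt{VC}^*$, $\mathtt{VC}^{*\mathrm a}$ are the maximal sizes of such sets. -}

module Defs where

open import Data.Bool using (Bool; true; false; not)
open import Data.Nat using (ℕ)
open import Data.Fin using (Fin)
open import Data.Product using (Σ; ∃; _×_; _,_)
open import Data.Sum using (_⊎_)
open import Relation.Binary.PropositionalEquality using (_≡_; _≢_)
open import Function.Bundles using (_⇔_)

-- Labels {-,+}: false = -, true = +; the sign flip is 'not'.
Sign : Set
Sign = Bool

record AntipodalDomain : Set₁ where
  field
    X       : Set
    neg     : X → X
    neg-inv : ∀ x → neg (neg x) ≡ x
    neg-fpf : ∀ x → neg x ≢ x

module _ (D : AntipodalDomain) where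
  open AntipodalDomain D

  Hyp : Set
  Hyp = X → Sign

  Class : Set₁
  Class = Hyp → Set

  Nonempty : Class → Set
  Nonempty 𝓗 = ∃ λ h → 𝓗 h

  IsAntipodalHyp : Hyp → Set
  IsAntipodalHyp h = ∀ x → h (neg x) ≡ not (h x)

  IsAntipodalClass : Class → Set
  IsAntipodalClass 𝓗 = ∀ h → 𝓗 h → IsAntipodalHyp h

  -- A subset H ⊆ 𝓗 given as an extensionally injective family indexed by I.
  record SubsetOf (𝓗 : Class) (I : Set) : Set where
    field
      elem    : I → Hyp
      member  : ∀ i → 𝓗 (elem i)
      distinct : ∀ i j → (∀ x → elem i x ≡ elem j x) → i ≡ j

  DuallyShatters : (𝓗 : Class) {I : Set} → SubsetOf 𝓗 I → Set
  DuallyShatters 𝓗 {I} H =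
    (r : I → Sign) → ∃ λ (x : X) → ∀ i → SubsetOf.elem H i x ≡ r i

  DuallyAntipodallyShatters : (𝓗 : Class) {I : Set} → SubsetOf 𝓗 I → Set
  DuallyAntipodallyShatters 𝓗 {I} H =
    (r : I → Sign) → ∃ λ (x : X) →
      (∀ i → SubsetOf.elem H i x ≡ r i) ⊎ (∀ i → SubsetOf.elem H i x ≡ not (r i))

  Shatters : Class → {n : ℕ} → (Fin n → X) → Set
  Shatters 𝓗 {n} S = (p : Fin n → Sign) → ∃ λ h → 𝓗 h × (∀ i → h (S i) ≡ p i)

  -- "VC(𝓗) ≥ n": 𝓗 shatters some set of n points.
  ShattersSize : Class → ℕ → Set
  ShattersSize 𝓗 n = Σ (Fin n → X) λ S → (∀ i j → S i ≡ S j → i ≡ j) × Shatters 𝓗 S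

  -- "VC*(𝓗) ≥ n"
  DualSize : Class → ℕ → Set
  DualSize 𝓗 n = Σ (SubsetOf 𝓗 (Fin n)) λ H → DuallyShatters 𝓗 H

  -- "VC*ᵃ(𝓗) ≥ n"
  DualASize : Class → ℕ → Set
  DualASize 𝓗 n = Σ (SubsetOf 𝓗 (Fin n)) λ H → DuallyAntipodallyShatters 𝓗 H

  IsRepresentationMap : (X → X) → Set
  IsRepresentationMap r =
    ∀ x → (r x ≡ x × r (neg x) ≡ x) ⊎ (r x ≡ neg x × r (neg x) ≡ neg x)

  -- h' is the symmetrization h^r of h by r (as a pointwise specification,
  -- which determines h' uniquely).
  IsSymmetrizationOf : (X → X) → Hyp → Hyp → Set
  IsSymmetrizationOf r h h' = ∀ x →
      (h x ≡ not (h (neg x)) → h' x ≡ h x)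
    × (h x ≢ not (h (neg x)) → x ≡ r x → h' x ≡ h x)
    × (h x ≢ not (h (neg x)) → x ≡ neg (r x) → h' x ≡ not (h x))

  Sym : Class → (X → X) → Class
  Sym 𝓗 r h' = ∃ λ h → 𝓗 h × IsSymmetrizationOf r h h'

{-# OPTIONS --safe #-}
module Submission where

-- (1) For antipodal hypotheses, a point x realising the flipped pattern -ρ
-- yields the point -x realising ρ.
-- (2) The symmetrization is h^r x = h (r x) if r x = x and h^r x = -h (r x) if
-- r x = -x, so h and h^r agree at every representative r x up to a sign that
-- depends on x alone.  Hence a set S shattered by 𝓗^r moves to the set r(S)
-- shattered by 𝓗 (flip the pattern wherever r x = -x), and a dual witness x for
-- hypotheses of 𝓗^r gives the dual witness r x for their origins in 𝓗.

open import Defs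
open import Data.Nat using (ℕ)
open import Data.Product using (_×_)
open import Function.Bundles using (_⇔_)

open import Data.Bool using (true; false; not; _≟_)
open import Data.Bool.Properties using (not-involutive; ¬-not)
open import Data.Fin using (Fin) renaming (_≟_ to _≟ᶠ_)
open import Data.Product using (_,_; proj₁; proj₂; map₂)
open import Data.Sum using (_⊎_; inj₁; inj₂) renaming (map to map⊎)
open import Function using (id; _∘_)
open import Function.Bundles using (mk⇔; Equivalence)
open import Relation.Nullary using (does; yes; no; contradiction)
open import Relation.Nullary.Decidable using (dec-true; dec-false; decidable-stable)
open import Relation.Binary.PropositionalEquality
open import Relation.Unary using (_⊆_)

AgreesUpToSign : {I : Set} → (I → Sign) → (I → Sign) → Set
AgreesUpToSign v ρ = (∀ i → v i ≡ ρ i) ⊎ (∀ i → v i ≡ not (ρ i))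

agreesUpToSign-resp-≗ : {I : Set} {v w ρ : I → Sign} →
                        (∀ i → v i ≡ w i) → AgreesUpToSign v ρ → AgreesUpToSign w ρ
agreesUpToSign-resp-≗ v≗w = map⊎ (λ v≡ρ i → trans (sym (v≗w i)) (v≡ρ i))
                                (λ v≡¬ρ i → trans (sym (v≗w i)) (v≡¬ρ i))

agreesUpToSign-not : {I : Set} {v ρ : I → Sign} →
                     AgreesUpToSign v ρ → AgreesUpToSign (not ∘ v) ρ
agreesUpToSign-not (inj₁ v≡ρ)  = inj₂ (λ i → cong not (v≡ρ i))
agreesUpToSign-not (inj₂ v≡¬ρ) = inj₁ (λ i → trans (cong not (v≡¬ρ i)) (not-involutive _))

orientation : {A B : Set} → A ⊎ B → Sign → Sign
orientation (inj₁ _) = id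
orientation (inj₂ _) = not

orientation-involutive : {A B : Set} (c : A ⊎ B) (b : Sign) →
                         orientation c (orientation c b) ≡ b
orientation-involutive (inj₁ _) b = refl
orientation-involutive (inj₂ _) b = not-involutive b

orientation-agreesUpToSign : {A B : Set} (c : A ⊎ B) {I : Set} {v ρ : I → Sign} →
                             AgreesUpToSign v ρ → AgreesUpToSign (orientation c ∘ v) ρ
orientation-agreesUpToSign (inj₁ _) = id
orientation-agreesUpToSign (inj₂ _) = agreesUpToSign-not

module _ (D : AntipodalDomain) where
  open AntipodalDomain D

  dualShatters⇒dualAntipodallyShatters : {𝓗 : Class D} {I : Set} (H : SubsetOf D 𝓗 I) →
                                         DuallyShatters D 𝓗 H → DuallyAntipodallyShatters D 𝓗 H
  dualShatters⇒dualAntipodallyShatters H shatters ρ = map₂ inj₁ (shatters ρ)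

  antipodal-dualAntipodallyShatters⇒dualShatters :
    {𝓗 : Class D} → IsAntipodalClass D 𝓗 → {I : Set} (H : SubsetOf D 𝓗 I) →
    DuallyAntipodallyShatters D 𝓗 H → DuallyShatters D 𝓗 H
  antipodal-dualAntipodallyShatters⇒dualShatters antipodal H shatters ρ with shatters ρ
  ... | x , inj₁ x-realizes = x , x-realizes
  ... | x , inj₂ x-realizes-¬ρ = neg x , λ i → begin
          elem i (neg x)     ≡⟨ antipodal (elem i) (member i) x ⟩
          not (elem i x)     ≡⟨ cong not (x-realizes-¬ρ i) ⟩
          not (not (ρ i))    ≡⟨ not-involutive (ρ i) ⟩
          ρ i                ∎
    where open SubsetOf H
          open ≡-Reasoning

  antipodal-dualShatters⇔dualAntipodallyShatters :
    {𝓗 : Class D} → IsAntipodalClass D 𝓗 → {I : Set} (H : SubsetOf D 𝓗 I) →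
    DuallyShatters D 𝓗 H ⇔ DuallyAntipodallyShatters D 𝓗 H
  antipodal-dualShatters⇔dualAntipodallyShatters antipodal H =
    mk⇔ (dualShatters⇒dualAntipodallyShatters H)
        (antipodal-dualAntipodallyShatters⇒dualShatters antipodal H)

  antipodal-dualSize⇔dualASize : {𝓗 : Class D} → IsAntipodalClass D 𝓗 → {n : ℕ} →
                                 DualSize D 𝓗 n ⇔ DualASize D 𝓗 n
  antipodal-dualSize⇔dualASize antipodal = mk⇔
    (map₂ λ {H} → Equivalence.to   (antipodal-dualShatters⇔dualAntipodallyShatters antipodal H))
    (map₂ λ {H} → Equivalence.from (antipodal-dualShatters⇔dualAntipodallyShatters antipodal H))

  shatters⇒injective : {𝓗 : Class D} {n : ℕ} {S : Fin n → X} →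
                       Shatters D 𝓗 S → ∀ i j → S i ≡ S j → i ≡ j
  shatters⇒injective {S = S} shatters i j Si≡Sj = decidable-stable (i ≟ᶠ j) λ i≢j →
    let h , _ , realizes = shatters (λ k → does (i ≟ᶠ k))
        true≡false : true ≡ false
        true≡false = begin
          true            ≡⟨ sym (dec-true (i ≟ᶠ i) refl) ⟩
          does (i ≟ᶠ i)   ≡⟨ sym (realizes i) ⟩
          h (S i)         ≡⟨ cong h Si≡Sj ⟩
          h (S j)         ≡⟨ realizes j ⟩
          does (i ≟ᶠ j)   ≡⟨ dec-false (i ≟ᶠ j) i≢j ⟩
          false           ∎
    in contradiction true≡false λ ()
    where open ≡-Reasoning

  Side : (X → X) → X → Set
  Side r x = r x ≡ x ⊎ r x ≡ neg x

  representationMap-side : {r : X → X} → IsRepresentationMap D r → ∀ x → Side r x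
  representationMap-side isRep x = map⊎ proj₁ proj₁ (isRep x)

  symmetrization-closedForm : {r : X → X} {h h' : Hyp D} → IsSymmetrizationOf D r h h' →
                              {x : X} (c : Side r x) → h' x ≡ orientation c (h (r x))
  symmetrization-closedForm {h = h} isSym {x} (inj₁ rx≡x)
    with h x ≟ not (h (neg x))
  ... | yes balanced   = trans (proj₁ (isSym x) balanced) (cong h (sym rx≡x))
  ... | no  unbalanced = trans (proj₁ (proj₂ (isSym x)) unbalanced (sym rx≡x)) (cong h (sym rx≡x))
  symmetrization-closedForm {r} {h} {h'} isSym {x} (inj₂ rx≡-x)
    with h x ≟ not (h (neg x))
  ... | yes balanced   = begin
          h' x                ≡⟨ proj₁ (isSym x) balanced ⟩
          h x                 ≡⟨ balanced ⟩
          not (h (neg x))     ≡⟨ cong (not ∘ h) (sym rx≡-x) ⟩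
          not (h (r x))       ∎
    where open ≡-Reasoning
  ... | no  unbalanced = begin
          h' x                ≡⟨ proj₂ (proj₂ (isSym x)) unbalanced x≡-rx ⟩
          not (h x)           ≡⟨ cong not (trans (¬-not unbalanced) (not-involutive _)) ⟩
          not (h (neg x))     ≡⟨ cong (not ∘ h) (sym rx≡-x) ⟩
          not (h (r x))       ∎
    where open ≡-Reasoning
          x≡-rx : x ≡ neg (r x)
          x≡-rx = trans (sym (neg-inv x)) (cong neg (sym rx≡-x))

  symmetrization-atRepresentative : {r : X → X} {h h' : Hyp D} → IsSymmetrizationOf D r h h' →
                                    {x : X} (c : Side r x) → h (r x) ≡ orientation c (h' x)
  symmetrization-atRepresentative {r} {h} {h'} isSym {x} c = begin
    h (r x)                                    ≡⟨ sym (orientation-involutive c _) ⟩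
    orientation c (orientation c (h (r x)))    ≡⟨ cong (orientation c) closedForm ⟩
    orientation c (h' x)                       ∎
    where open ≡-Reasoning
          closedForm = sym (symmetrization-closedForm isSym c)

  symmetrization-cong : {r : X → X} → (∀ x → Side r x) → {g g' h h' : Hyp D} →
                        IsSymmetrizationOf D r g g' → IsSymmetrizationOf D r h h' →
                        (∀ x → g x ≡ h x) → ∀ x → g' x ≡ h' x
  symmetrization-cong {r} side {g} {g'} {h} {h'} gSym hSym g≗h x = begin
    g' x                           ≡⟨ symmetrization-closedForm gSym (side x) ⟩
    orientation (side x) (g (r x)) ≡⟨ cong (orientation (side x)) (g≗h (r x)) ⟩
    orientation (side x) (h (r x)) ≡⟨ sym (symmetrization-closedForm hSym (side x)) ⟩
    h' x                           ∎
    where open ≡-Reasoning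

  module _ {𝓗 𝓗' : Class D} {r : X → X} (side : ∀ x → Side r x) (𝓗'⊆𝓗ʳ : 𝓗' ⊆ Sym D 𝓗 r) where

    origin : {h' : Hyp D} → 𝓗' h' → Hyp D
    origin h'∈𝓗' = proj₁ (𝓗'⊆𝓗ʳ h'∈𝓗')

    origin-∈ : {h' : Hyp D} (h'∈𝓗' : 𝓗' h') → 𝓗 (origin h'∈𝓗')
    origin-∈ h'∈𝓗' = proj₁ (proj₂ (𝓗'⊆𝓗ʳ h'∈𝓗'))

    origin-symmetrizes : {h' : Hyp D} (h'∈𝓗' : 𝓗' h') → IsSymmetrizationOf D r (origin h'∈𝓗') h'
    origin-symmetrizes h'∈𝓗' = proj₂ (proj₂ (𝓗'⊆𝓗ʳ h'∈𝓗'))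

    shatters-representatives : {n : ℕ} {S : Fin n → X} → Shatters D 𝓗' S → Shatters D 𝓗 (r ∘ S)
    shatters-representatives {S = S} shatters p =
      let h' , h'∈𝓗' , h'-realizes = shatters (λ i → orientation (side (S i)) (p i))
          h = origin h'∈𝓗'
          h-realizes : ∀ i → h (r (S i)) ≡ p i
          h-realizes i = let c = side (S i) in begin
            h (r (S i))                          ≡⟨ symmetrization-atRepresentative (origin-symmetrizes h'∈𝓗') c ⟩
            orientation c (h' (S i))             ≡⟨ cong (orientation c) (h'-realizes i) ⟩
            orientation c (orientation c (p i))  ≡⟨ orientation-involutive c (p i) ⟩
            p i                                  ∎
      in h , origin-∈ h'∈𝓗' , h-realizes
      where open ≡-Reasoning

    shattersSize-mono : ∀ n → ShattersSize D 𝓗' n → ShattersSize D 𝓗 n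
    shattersSize-mono _ (S , _ , shatters) =
      r ∘ S , shatters⇒injective shatters′ , shatters′
      where shatters′ = shatters-representatives shatters

    unsymmetrize : {I : Set} → SubsetOf D 𝓗' I → SubsetOf D 𝓗 I
    unsymmetrize H' = record
      { elem     = λ i → origin (member i)
      ; member   = λ i → origin-∈ (member i)
      ; distinct = λ i j origins≗ → distinct i j
          (symmetrization-cong side (origin-symmetrizes (member i)) (origin-symmetrizes (member j)) origins≗)
      }
      where open SubsetOf H'

    unsymmetrize-dualAntipodallyShatters : {I : Set} (H' : SubsetOf D 𝓗' I) →
      DuallyAntipodallyShatters D 𝓗' H' → DuallyAntipodallyShatters D 𝓗 (unsymmetrize H')
    unsymmetrize-dualAntipodallyShatters H' shatters ρ =
      let x , x-agrees = shatters ρ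
      in r x , agreesUpToSign-resp-≗
                 (λ i → sym (symmetrization-atRepresentative (origin-symmetrizes (member i)) (side x)))
                 (orientation-agreesUpToSign (side x) x-agrees)
      where open SubsetOf H'

    dualASize-mono : ∀ n → DualASize D 𝓗' n → DualASize D 𝓗 n
    dualASize-mono _ (H' , shatters) = unsymmetrize H' , unsymmetrize-dualAntipodallyShatters H' shatters

propositionC1 : (D : AntipodalDomain) →
    ((𝓗 : Class D) → Nonempty D 𝓗 → IsAntipodalClass D 𝓗 →
        ((I : Set) (H : SubsetOf D 𝓗 I) →
            DuallyShatters D 𝓗 H ⇔ DuallyAntipodallyShatters D 𝓗 H)
      × ((n : ℕ) → DualSize D 𝓗 n ⇔ DualASize D 𝓗 n))
    × ((𝓗 𝓗' : Class D) → Nonempty D 𝓗 → (r : AntipodalDomain.X D → AntipodalDomain.X D) →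
        IsRepresentationMap D r → (∀ h → 𝓗' h ⇔ Sym D 𝓗 r h) →
        ((n : ℕ) → ShattersSize D 𝓗' n → ShattersSize D 𝓗 n)
      × ((n : ℕ) → DualASize D 𝓗' n → DualASize D 𝓗 n))
propositionC1 D = part₁ , part₂
  where
  part₁ = λ _ _ antipodal →
    (λ _ → antipodal-dualShatters⇔dualAntipodallyShatters D antipodal) ,
    (λ _ → antipodal-dualSize⇔dualASize D antipodal)
  part₂ = λ _ _ _ _ isRep 𝓗'⇔𝓗ʳ →
    let side  = representationMap-side D isRep
        𝓗'⊆𝓗ʳ = λ {h} → Equivalence.to (𝓗'⇔𝓗ʳ h)
    in shattersSize-mono D side 𝓗'⊆𝓗ʳ , dualASize-mono D side 𝓗'⊆𝓗ʳ
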